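{- Let $n\ge 3$, let $G_1,G_2$ be disjoint copies of $C_n$, and let $f:V(G_1)\to V(G_2)$ be a bijection. Then $\gamma(C(C_n,f))=\gamma(C_n)$ if and only if $C(C_n,f)$ is isomorphic to $C(C_4,id)$, where $id$ maps the $i$-th vertex of the first copy of $C_4$ to the $i$-th vertex of the second copy (both labeled cyclically), i.e. $C(C_4,id)\cong C_4\times K_2$.
   Context: For disjoint copies $G_1,G_2$ of a graph $G$ and a function $f:V(G_1)\to V(G_2)$, the functigraph $C(G,f)$ has vertex set $V(G_1)\cup V(G_2)$ and edge set $E(G_1)\cup E(G_2)\cup\{uv : u\in V(G_1), v\in V(G_2), v=f(u)\}$. $\gamma$ denotes domination number. -}

module Defs where

open import Data.Nat using (ℕ; _≤_; NonZero)
open import Data.Nat.DivMod using (_mod_)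
open import Data.Fin using (Fin; toℕ)
open import Data.Sum using (_⊎_; inj₁; inj₂)
open import Data.Product using (Σ; ∃; _×_; _,_)
open import Data.List using (List; length)
open import Data.List.Membership.Propositional using (_∈_)
open import Data.List.Relation.Unary.Unique.Propositional using (Unique)
open import Data.Empty using (⊥)
open import Relation.Binary.PropositionalEquality using (_≡_)
open import Function.Bundles using (_↔_; _⇔_; Inverse)

record Graph : Set₁ where
  field
    V   : Set
    Adj : V → V → Set
open Graph public

Cycle : (n : ℕ) → .{{_ : NonZero n}} → Graph
Cycle n = record
  { V   = Fin n
  ; Adj = λ i j → ((Data.Nat.suc (toℕ i)) mod n ≡ j) ⊎ ((Data.Nat.suc (toℕ j)) mod n ≡ i)
  }

FAdj : (G : Graph) → (V G → V G) → V G ⊎ V G → V G ⊎ V G → Set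
FAdj G f (inj₁ a) (inj₁ b) = Adj G a b
FAdj G f (inj₂ a) (inj₂ b) = Adj G a b
FAdj G f (inj₁ u) (inj₂ v) = v ≡ f u
FAdj G f (inj₂ v) (inj₁ u) = v ≡ f u

Functigraph : (G : Graph) → (V G → V G) → Graph
Functigraph G f = record { V = V G ⊎ V G ; Adj = FAdj G f }

-- D (a duplicate-free list of vertices, i.e. a finite vertex set) is dominating.
Dominating : (G : Graph) → List (V G) → Set
Dominating G D = (v : V G) → v ∈ D ⊎ Σ (V G) (λ u → u ∈ D × Adj G u v)

IsDominationNumber : Graph → ℕ → Set
IsDominationNumber G k =
  (Σ (List (V G)) λ D → Unique D × Dominating G D × length D ≡ k)
  × ((D : List (V G)) → Unique D → Dominating G D → k ≤ length D)

SameDominationNumber : Graph → Graph → Set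
SameDominationNumber G H = Σ ℕ λ k → IsDominationNumber G k × IsDominationNumber H k

_≅_ : Graph → Graph → Set
G ≅ H = Σ (V G ↔ V H) λ φ →
  (u v : V G) → Adj G u v ⇔ Adj H (Inverse.to φ u) (Inverse.to φ v)

-- A vertex of C_n closes 3 vertices and, f being a bijection, a vertex of C(C_n,f) closes 4,
-- so n ≤ 3 γ(C_n) and 2n ≤ 4 γ(C(C_n,f)).  Together with γ(C_n) ≤ ⌈n/3⌉ an equality
-- γ(C(C_n,f)) = γ(C_n) = k forces n = 4 and k = 2.  A dominating pair of C(C_4,f) must have
-- one vertex a in each copy, which forces f(a + 2) = f(a) + 2; a bijection of ℤ/4 with this
-- property commutes with the antipodal map, hence is an automorphism of C_4, and then
-- inj₁ u ↦ inj₁ (f u) is an isomorphism C(C_4,f) ≅ C(C_4,id).  Conversely an isomorphism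
-- forces 2n = 8, and both domination numbers are 2.
module Submission where

open import Defs
open import Data.Nat using (ℕ; suc; _+_; _*_; _≤_; _<_; NonZero; s≤s)
open import Data.Nat.Properties
  using (≤-trans; ≤-antisym; ≤-reflexive; ≤-pred; <⇒≤; ≤∧≢⇒<; n≤1+n; +-comm; +-identityʳ;
         +-mono-≤; +-monoˡ-≤; +-monoʳ-≤; +-cancelˡ-≤; +-cancelʳ-≤; *-comm; *-suc; *-zeroʳ;
         *-monoʳ-≤; *-cancelˡ-≤; *-cancelˡ-<; *-cancelˡ-≡; module ≤-Reasoning)
  renaming (_≟_ to _≟ℕ_)
open import Data.Nat.DivMod
  using (_mod_; _/_; _%_; m≡m%n+[m/n]*n; m%n<n; m<n⇒m%n≡m; n%n≡0; m/n*n≤m; m*n/n≡m; /-monoˡ-≤)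
open import Data.Nat.Tactic.RingSolver using (solve-∀)
open import Data.Fin using (Fin; zero; suc; toℕ; fromℕ; fromℕ<; inject₁)
open import Data.Fin.Patterns using (0F; 1F; 2F; 3F)
open import Data.Fin.Properties
  using (_≟_; all?; toℕ-injective; toℕ<n; toℕ-fromℕ; toℕ-fromℕ<; toℕ-inject₁; +↔⊎;
         injective⇒≤; cantor-schröder-bernstein)
open import Data.Sum using (_⊎_; inj₁; inj₂; [_,_]; map₁; swap) renaming (map to ⊎-map)
open import Data.Sum.Properties using (inj₁-injective; inj₂-injective)
open import Data.Sum.Function.Propositional using (_⊎-↔_)
open import Data.Product using (Σ; _×_; _,_; proj₁; proj₂)
open import Data.List using (List; []; _∷_; _++_; length; map; concatMap; upTo; lookup; deduplicate)
open import Data.List.Properties using (length-++; length-map; length-upTo; length-deduplicate)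
open import Data.List.Membership.Propositional using (_∈_)
open import Data.List.Membership.Propositional.Properties
  using (∈-map⁺; ∈-++⁺ˡ; ∈-++⁺ʳ; ∈-concatMap⁺; ∈-upTo⁺; ∈-deduplicate⁺)
open import Data.List.Relation.Unary.Any using (here; there; index) renaming (map to any-map)
open import Data.List.Relation.Unary.Any.Properties using (lookup-index)
open import Data.List.Relation.Unary.All using ([]; _∷_)
open import Data.List.Relation.Unary.AllPairs using ([]; _∷_)
open import Data.List.Relation.Unary.Unique.Propositional using (Unique)
open import Data.List.Relation.Unary.Unique.Propositional.Properties using (map⁺)
open import Data.List.Relation.Unary.Unique.DecPropositional.Properties using (deduplicate-!)
open import Data.Empty using (⊥-elim)
open import Relation.Nullary using (¬_; ¬?; yes; no)
open import Relation.Nullary.Decidable using (Dec; toWitness; _×-dec_; _⊎-dec_; _→-dec_)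
open import Relation.Binary.Definitions using (DecidableEquality)
open import Relation.Binary.PropositionalEquality
  using (_≡_; _≢_; refl; sym; trans; cong; subst; module ≡-Reasoning)
open import Function using (id; _∘_)
open import Function.Bundles using (_↔_; _⇔_; mk⇔; mk⤖; Inverse; Injection; Equivalence)
open import Function.Definitions using (Injective; Bijective)
open import Function.Properties.Bijection using (⤖⇒↔)
open import Function.Properties.Inverse using (↔-refl; ↔-sym; ↔-trans; ↔⇒↣)

InClosedNbhd : (G : Graph) → V G → V G → Set
InClosedNbhd G u v = u ≡ v ⊎ Adj G u v

cover⇒≤length : ∀ {A : Set} {m} (e : Fin m → A) → Injective _≡_ _≡_ e →
                (L : List A) → (∀ i → e i ∈ L) → m ≤ length L
cover⇒≤length e e-injective L cover = injective⇒≤ position-injective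
  where
  open ≡-Reasoning
  position-injective : Injective _≡_ _≡_ (λ i → index (cover i))
  position-injective {i} {j} eq = e-injective (begin
    e i                        ≡⟨ lookup-index (cover i) ⟩
    lookup L (index (cover i)) ≡⟨ cong (lookup L) eq ⟩
    lookup L (index (cover j)) ≡⟨ lookup-index (cover j) ⟨
    e j                        ∎)

module _ (G : Graph) {c : ℕ} (N[_] : V G → List (V G))
         (length-N : ∀ u → length N[ u ] ≡ c)
         (u∈N[u] : ∀ u → u ∈ N[ u ])
         (adj⇒∈N : ∀ u v → Adj G u v → v ∈ N[ u ]) where

  length-concatMap-N : ∀ D → length (concatMap N[_] D) ≡ c * length D
  length-concatMap-N [] = sym (*-zeroʳ c)
  length-concatMap-N (u ∷ D) = begin
    length (N[ u ] ++ concatMap N[_] D)        ≡⟨ length-++ N[ u ] ⟩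
    length N[ u ] + length (concatMap N[_] D)  ≡⟨ cong (_+ _) (length-N u) ⟩
    c + length (concatMap N[_] D)              ≡⟨ cong (c +_) (length-concatMap-N D) ⟩
    c + c * length D                           ≡⟨ *-suc c (length D) ⟨
    c * length (u ∷ D)                         ∎
    where open ≡-Reasoning

  Dominating⇒≤*length : ∀ {m} (e : Fin m → V G) → Injective _≡_ _≡_ e →
                        (D : List (V G)) → Dominating G D → m ≤ c * length D
  Dominating⇒≤*length e e-injective D dom = subst (_ ≤_) (length-concatMap-N D)
    (cover⇒≤length e e-injective (concatMap N[_] D) (closed-nbhds-cover ∘ e))
    where
    closed-nbhds-cover : ∀ v → v ∈ concatMap N[_] D
    closed-nbhds-cover v with dom v
    ... | inj₁ v∈D             = ∈-concatMap⁺ N[_] (any-map (λ { refl → u∈N[u] v }) v∈D)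
    ... | inj₂ (u , u∈D , adj) = ∈-concatMap⁺ N[_] (any-map (λ { refl → adj⇒∈N u v adj }) u∈D)

deduplicate-Dominating : (G : Graph) (_≟V_ : DecidableEquality (V G)) {D : List (V G)} →
                         Dominating G D → Dominating G (deduplicate _≟V_ D)
deduplicate-Dominating G _≟V_ dom v with dom v
... | inj₁ v∈D             = inj₁ (∈-deduplicate⁺ _≟V_ v∈D)
... | inj₂ (u , u∈D , adj) = inj₂ (u , ∈-deduplicate⁺ _≟V_ u∈D , adj)

dominating-pair : (G : Graph) {x y : V G} → Dominating G (x ∷ y ∷ []) →
                  ∀ v → InClosedNbhd G x v ⊎ InClosedNbhd G y v
dominating-pair G dom v with dom v
... | inj₁ (here refl)                   = inj₁ (inj₁ refl)
... | inj₁ (there (here refl))           = inj₂ (inj₁ refl)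
... | inj₂ (_ , here refl , adj)         = inj₁ (inj₂ adj)
... | inj₂ (_ , there (here refl) , adj) = inj₂ (inj₂ adj)

isDominationNumber : (G : Graph) {k : ℕ} (D : List (V G)) → Unique D → Dominating G D →
                     length D ≤ k → (∀ D → Unique D → Dominating G D → k ≤ length D) →
                     IsDominationNumber G k
isDominationNumber G D unique dom |D|≤k minimal =
  (D , unique , dom , ≤-antisym |D|≤k (minimal D unique dom)) , minimal

≅-Dominating : {G H : Graph} → G ≅ H → (D : List (V H)) → Unique D → Dominating H D →
               Σ (List (V G)) λ D′ → Unique D′ × Dominating G D′ × length D′ ≡ length D
≅-Dominating {G} {H} (φ , preserves) D unique dom =
  map from D , map⁺ from-injective unique , dominating , length-map from D
  where
  open Inverse φ
  to∘from : ∀ y → to (from y) ≡ y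
  to∘from y = inverseˡ refl
  from-injective : Injective _≡_ _≡_ from
  from-injective {x} {y} eq = trans (sym (to∘from x)) (trans (cong to eq) (to∘from y))
  dominating : Dominating G (map from D)
  dominating v with dom (to v)
  ... | inj₁ tov∈D = inj₁ (subst (_∈ map from D) (inverseʳ refl) (∈-map⁺ from tov∈D))
  ... | inj₂ (w , w∈D , adj) =
    inj₂ (from w , ∈-map⁺ from w∈D ,
          Equivalence.from (preserves (from w) v) (subst (λ u → Adj H u (to v)) (sym (to∘from w)) adj))

automorphism⇒Functigraph-≅-id : (G : Graph) (f : V G → V G) → Bijective _≡_ _≡_ f →
                                (∀ u v → Adj G u v ⇔ Adj G (f u) (f v)) →
                                Functigraph G f ≅ Functigraph G id
automorphism⇒Functigraph-≅-id G f bij automorphism = φ , preserves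
  where
  φ : (V G ⊎ V G) ↔ (V G ⊎ V G)
  φ = ⤖⇒↔ (mk⤖ bij) ⊎-↔ ↔-refl
  preserves : ∀ u v → FAdj G f u v ⇔ FAdj G id (Inverse.to φ u) (Inverse.to φ v)
  preserves (inj₁ a) (inj₁ b) = automorphism a b
  preserves (inj₂ a) (inj₂ b) = mk⇔ id id
  preserves (inj₁ u) (inj₂ v) = mk⇔ id id
  preserves (inj₂ v) (inj₁ u) = mk⇔ id id

Fin-↔⇒≡ : ∀ {m n} → Fin m ↔ Fin n → m ≡ n
Fin-↔⇒≡ φ =
  cantor-schröder-bernstein (Injection.injective (↔⇒↣ φ)) (Injection.injective (↔⇒↣ (↔-sym φ)))

≅-Functigraph-Cycle⇒≡ : ∀ {m n} .{{_ : NonZero m}} .{{_ : NonZero n}}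
                        {f : Fin m → Fin m} {g : Fin n → Fin n} →
                        Functigraph (Cycle m) f ≅ Functigraph (Cycle n) g → m ≡ n
≅-Functigraph-Cycle⇒≡ {m} {n} (φ , _) = *-cancelˡ-≡ m n 2 (begin
  m + (m + 0) ≡⟨ cong (m +_) (+-identityʳ m) ⟩
  m + m       ≡⟨ Fin-↔⇒≡ (↔-trans +↔⊎ (↔-trans φ (↔-sym +↔⊎))) ⟩
  n + n       ≡⟨ cong (n +_) (+-identityʳ n) ⟨
  n + (n + 0) ∎)
  where open ≡-Reasoning

next : ∀ {n} .{{_ : NonZero n}} → Fin n → Fin n
next {n} i = suc (toℕ i) mod n

prev : ∀ {n} → Fin n → Fin n
prev {suc m} zero    = fromℕ m
prev {suc m} (suc i) = inject₁ i

toℕ-mod : ∀ {n k} .{{_ : NonZero n}} → k < n → toℕ (k mod n) ≡ k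
toℕ-mod k<n = trans (toℕ-fromℕ< _) (m<n⇒m%n≡m k<n)

toℕ-mod-toℕ : ∀ {n} .{{_ : NonZero n}} (i : Fin n) → toℕ i mod n ≡ i
toℕ-mod-toℕ i = toℕ-injective (toℕ-mod (toℕ<n i))

prev-next : ∀ {n} .{{_ : NonZero n}} (i : Fin n) → prev (next i) ≡ i
prev-next {suc m} i with toℕ i ≟ℕ m
... | yes i≡m = toℕ-injective (begin
  toℕ (prev (next i)) ≡⟨ cong (toℕ ∘ prev) next-last ⟩
  toℕ (fromℕ m)       ≡⟨ toℕ-fromℕ m ⟩
  m                   ≡⟨ i≡m ⟨
  toℕ i               ∎)
  where
  open ≡-Reasoning
  next-last : next i ≡ zero
  next-last = toℕ-injective
    (trans (toℕ-fromℕ< _) (trans (cong (λ k → suc k % suc m) i≡m) (n%n≡0 (suc m))))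
... | no i≢m = toℕ-injective (begin
  toℕ (prev (next i))            ≡⟨ cong (toℕ ∘ prev) next-below-last ⟩
  toℕ (inject₁ (fromℕ< i<m))     ≡⟨ toℕ-inject₁ (fromℕ< i<m) ⟩
  toℕ (fromℕ< i<m)               ≡⟨ toℕ-fromℕ< i<m ⟩
  toℕ i                          ∎)
  where
  open ≡-Reasoning
  i<m : toℕ i < m
  i<m = ≤∧≢⇒< (≤-pred (toℕ<n i)) i≢m
  next-below-last : next i ≡ suc (fromℕ< i<m)
  next-below-last = toℕ-injective (trans (toℕ-mod (s≤s i<m)) (cong suc (sym (toℕ-fromℕ< i<m))))

cycle-nbhd : ∀ {n} .{{_ : NonZero n}} → Fin n → List (Fin n)
cycle-nbhd a = a ∷ next a ∷ prev a ∷ []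

cycle-adj⇒∈nbhd : ∀ {n} .{{_ : NonZero n}} {a b : Fin n} → Adj (Cycle n) a b → b ∈ cycle-nbhd a
cycle-adj⇒∈nbhd (inj₁ next-a≡b) = there (here (sym next-a≡b))
cycle-adj⇒∈nbhd {b = b} (inj₂ next-b≡a) =
  there (there (here (trans (sym (prev-next b)) (cong prev next-b≡a))))

cycle-adj? : ∀ {n} .{{_ : NonZero n}} (a b : Fin n) → Dec (Adj (Cycle n) a b)
cycle-adj? a b = (next a ≟ b) ⊎-dec (next b ≟ a)

Cycle-Dominating⇒≤ : ∀ n .{{_ : NonZero n}} (D : List (Fin n)) → Dominating (Cycle n) D →
                     n ≤ 3 * length D
Cycle-Dominating⇒≤ n =
  Dominating⇒≤*length (Cycle n) cycle-nbhd (λ _ → refl) (λ _ → here refl) (λ _ _ → cycle-adj⇒∈nbhd) id id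

Functigraph-Dominating⇒≤ : ∀ {n} .{{_ : NonZero n}} (f : Fin n → Fin n) → Bijective _≡_ _≡_ f →
                           (D : List (Fin n ⊎ Fin n)) → Dominating (Functigraph (Cycle n) f) D →
                           n + n ≤ 4 * length D
Functigraph-Dominating⇒≤ {n} f bij =
  Dominating⇒≤*length (Functigraph (Cycle n) f) N[_] length-N u∈N[u] adj⇒∈N
    (Inverse.to +↔⊎) (Injection.injective (↔⇒↣ +↔⊎))
  where
  open Inverse (⤖⇒↔ (mk⤖ bij)) using (from; inverseʳ)
  N[_] : Fin n ⊎ Fin n → List (Fin n ⊎ Fin n)
  N[ inj₁ a ] = map inj₁ (cycle-nbhd a) ++ inj₂ (f a) ∷ []
  N[ inj₂ b ] = map inj₂ (cycle-nbhd b) ++ inj₁ (from b) ∷ []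
  length-N : ∀ u → length N[ u ] ≡ 4
  length-N (inj₁ _) = refl
  length-N (inj₂ _) = refl
  u∈N[u] : ∀ u → u ∈ N[ u ]
  u∈N[u] (inj₁ _) = here refl
  u∈N[u] (inj₂ _) = here refl
  adj⇒∈N : ∀ u v → FAdj (Cycle n) f u v → v ∈ N[ u ]
  adj⇒∈N (inj₁ _) (inj₁ _) adj  = ∈-++⁺ˡ (∈-map⁺ inj₁ (cycle-adj⇒∈nbhd adj))
  adj⇒∈N (inj₂ _) (inj₂ _) adj  = ∈-++⁺ˡ (∈-map⁺ inj₂ (cycle-adj⇒∈nbhd adj))
  adj⇒∈N (inj₁ a) (inj₂ _) v≡fa = ∈-++⁺ʳ (map inj₁ (cycle-nbhd a)) (here (cong inj₂ v≡fa))
  adj⇒∈N (inj₂ b) (inj₁ _) b≡fu = ∈-++⁺ʳ (map inj₂ (cycle-nbhd b)) (here (cong inj₁ (sym (inverseʳ b≡fu))))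

k/3<⌈n/3⌉ : ∀ {k n} → k < n → k / 3 < (n + 2) / 3
k/3<⌈n/3⌉ {k} {n} k<n = begin
  suc (k / 3)             ≡⟨ m*n/n≡m (suc (k / 3)) 3 ⟨
  (3 + k / 3 * 3) / 3     ≤⟨ /-monoˡ-≤ 3 (begin
    3 + k / 3 * 3           ≤⟨ +-monoʳ-≤ 3 (m/n*n≤m k 3) ⟩
    3 + k                   ≡⟨ cong suc (+-comm 2 k) ⟩
    suc k + 2               ≤⟨ +-monoˡ-≤ 2 k<n ⟩
    n + 2                   ∎) ⟩
  (n + 2) / 3             ∎
  where open ≤-Reasoning

-- Vertex v is dominated by the centre 1 + 3⌊v/3⌋, reduced mod n (which matters only when it is n).
Cycle-dominating-set : ∀ n .{{_ : NonZero n}} →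
                       Σ (List (Fin n)) λ D → Unique D × Dominating (Cycle n) D × 3 * length D ≤ n + 2
Cycle-dominating-set n =
  deduplicate _≟_ centres , deduplicate-! _≟_ centres ,
  deduplicate-Dominating (Cycle n) _≟_ centres-dominate , size
  where
  m : ℕ
  m = (n + 2) / 3
  centre : ℕ → Fin n
  centre j = (1 + j * 3) mod n
  centres : List (Fin n)
  centres = map centre (upTo m)
  size : 3 * length (deduplicate _≟_ centres) ≤ n + 2
  size = begin
    3 * length (deduplicate _≟_ centres) ≤⟨ *-monoʳ-≤ 3 (length-deduplicate _≟_ centres) ⟩
    3 * length centres                   ≡⟨ cong (3 *_) (trans (length-map centre (upTo m)) (length-upTo m)) ⟩
    3 * m                                ≡⟨ *-comm 3 m ⟩
    m * 3                                ≤⟨ m/n*n≤m (n + 2) 3 ⟩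
    n + 2                                ∎
    where open ≤-Reasoning
  dominator : Fin n → Fin n
  dominator v = centre (toℕ v / 3)
  dominator∈centres : ∀ v → dominator v ∈ centres
  dominator∈centres v = ∈-map⁺ centre (∈-upTo⁺ (k/3<⌈n/3⌉ (toℕ<n v)))
  centres-dominate : Dominating (Cycle n) centres
  centres-dominate v with toℕ v % 3 | m≡m%n+[m/n]*n (toℕ v) 3 | m%n<n (toℕ v) 3
  ... | 0 | v≡q*3 | _ =
    inj₂ (dominator v , dominator∈centres v , inj₂ (cong (λ k → suc k mod n) v≡q*3))
  ... | 1 | v≡1+q*3 | _ =
    inj₁ (subst (_∈ centres) (trans (cong (_mod n) (sym v≡1+q*3)) (toℕ-mod-toℕ v)) (dominator∈centres v))
  ... | 2 | v≡2+q*3 | _ = inj₂ (dominator v , dominator∈centres v , inj₁ next-dominator≡v)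
    where
    open ≡-Reasoning
    q : ℕ
    q = toℕ v / 3
    1+q*3<n : 1 + q * 3 < n
    1+q*3<n = ≤-trans (≤-reflexive (sym v≡2+q*3)) (<⇒≤ (toℕ<n v))
    next-dominator≡v : next (dominator v) ≡ v
    next-dominator≡v = begin
      suc (toℕ (centre q)) mod n ≡⟨ cong (λ k → suc k mod n) (toℕ-mod 1+q*3<n) ⟩
      (2 + q * 3) mod n          ≡⟨ cong (_mod n) (sym v≡2+q*3) ⟩
      toℕ v mod n                ≡⟨ toℕ-mod-toℕ v ⟩
      v                          ∎
  ... | suc (suc (suc _)) | _ | s≤s (s≤s (s≤s ()))

opp : Fin 4 → Fin 4
opp 0F = 2F
opp 1F = 3F
opp 2F = 0F
opp 3F = 1F

opp-involutive : ∀ a → opp (opp a) ≡ a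
opp-involutive 0F = refl
opp-involutive 1F = refl
opp-involutive 2F = refl
opp-involutive 3F = refl

opp-∉-closedNbhd : ∀ a → ¬ InClosedNbhd (Cycle 4) a (opp a)
opp-∉-closedNbhd = toWitness {a? = all? λ a → ¬? ((a ≟ opp a) ⊎-dec cycle-adj? a (opp a))} _

Cycle₄-adj⇔ : ∀ a b → Adj (Cycle 4) a b ⇔ (b ≢ a × b ≢ opp a)
Cycle₄-adj⇔ a b = mk⇔ (proj₁ (both-ways a b)) (proj₂ (both-ways a b))
  where
  both-ways : ∀ a b → (Adj (Cycle 4) a b → b ≢ a × b ≢ opp a) × (b ≢ a × b ≢ opp a → Adj (Cycle 4) a b)
  both-ways = toWitness {a? = all? λ a → all? λ b →
    let adj? = cycle-adj? a b ; neither? = ¬? (b ≟ a) ×-dec ¬? (b ≟ opp a)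
    in (adj? →-dec neither?) ×-dec (neither? →-dec adj?)} _

complement-antipodal : ∀ b p q → p ≢ b → p ≢ opp b → q ≢ b → q ≢ opp b → q ≢ p → q ≡ opp p
complement-antipodal = toWitness {a? = all? λ b → all? λ p → all? λ q →
  ¬? (p ≟ b) →-dec ¬? (p ≟ opp b) →-dec ¬? (q ≟ b) →-dec ¬? (q ≟ opp b) →-dec ¬? (q ≟ p) →-dec
  q ≟ opp p} _

two-points-cannot-cover : ∀ {n} (p q : Fin (3 + n)) → ¬ (∀ v → v ≡ p ⊎ v ≡ q)
two-points-cannot-cover p q cover with cover 0F | cover 1F | cover 2F
... | inj₁ refl | inj₁ ()   | _
... | inj₂ refl | inj₂ ()   | _
... | inj₁ refl | inj₂ refl | inj₁ ()
... | inj₁ refl | inj₂ refl | inj₂ ()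
... | inj₂ refl | inj₁ refl | inj₁ ()
... | inj₂ refl | inj₁ refl | inj₂ ()

CommutesWithOpp : (Fin 4 → Fin 4) → Set
CommutesWithOpp f = ∀ a → f (opp a) ≡ opp (f a)

commutes-with-opp-at⇒CommutesWithOpp : (f : Fin 4 → Fin 4) → Injective _≡_ _≡_ f →
                                        ∀ {a} → f (opp a) ≡ opp (f a) → CommutesWithOpp f
commutes-with-opp-at⇒CommutesWithOpp f f-injective {a} at-a c with c ≟ a | c ≟ opp a
... | yes refl | _ = at-a
... | no _ | yes refl = begin
  f (opp (opp a))  ≡⟨ cong f (opp-involutive a) ⟩
  f a              ≡⟨ opp-involutive (f a) ⟨
  opp (opp (f a))  ≡⟨ cong opp at-a ⟨
  opp (f (opp a))  ∎
  where open ≡-Reasoning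
-- f c and f (opp c) avoid the antipodal pair {f a, f (opp a)}, so they form the other one.
... | no c≢a | no c≢opp-a = complement-antipodal (f a) (f c) (f (opp c))
  (c≢a ∘ f-injective)
  (λ fc≡opp-fa → c≢opp-a (f-injective (trans fc≡opp-fa (sym at-a))))
  (λ f-opp-c≡fa → c≢opp-a (opp-swap (f-injective f-opp-c≡fa)))
  (λ f-opp-c≡opp-fa → c≢a (opp-injective (f-injective (trans f-opp-c≡opp-fa (sym at-a)))))
  (λ f-opp-c≡fc → opp-∉-closedNbhd c (inj₁ (sym (f-injective f-opp-c≡fc))))
  where
  opp-injective : ∀ {x y} → opp x ≡ opp y → x ≡ y
  opp-injective {x} {y} eq = trans (sym (opp-involutive x)) (trans (cong opp eq) (opp-involutive y))
  opp-swap : ∀ {x y} → opp x ≡ y → x ≡ opp y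
  opp-swap {x} eq = trans (sym (opp-involutive x)) (cong opp eq)

CommutesWithOpp⇒automorphism : (f : Fin 4 → Fin 4) → Injective _≡_ _≡_ f → CommutesWithOpp f →
                               ∀ a b → Adj (Cycle 4) a b ⇔ Adj (Cycle 4) (f a) (f b)
CommutesWithOpp⇒automorphism f f-injective commutes a b = mk⇔
  (λ adj → let (b≢a , b≢opp-a) = Equivalence.to (Cycle₄-adj⇔ a b) adj in
    Equivalence.from (Cycle₄-adj⇔ (f a) (f b))
      ( b≢a ∘ f-injective
      , λ fb≡opp-fa → b≢opp-a (f-injective (trans fb≡opp-fa (sym (commutes a))))))
  (λ adj → let (fb≢fa , fb≢opp-fa) = Equivalence.to (Cycle₄-adj⇔ (f a) (f b)) adj in
    Equivalence.from (Cycle₄-adj⇔ a b)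
      ( fb≢fa ∘ cong f
      , λ b≡opp-a → fb≢opp-fa (trans (cong f b≡opp-a) (commutes a))))

-- A dominating pair has one vertex in each copy: inj₁ a dominates inj₂ (opp b) and
-- inj₂ b dominates inj₁ (opp a), i.e. f a = opp b and f (opp a) = b.
dominating-pair⇒CommutesWithOpp : (f : Fin 4 → Fin 4) → Bijective _≡_ _≡_ f → ∀ x y →
  (∀ v → InClosedNbhd (Functigraph (Cycle 4) f) x v ⊎ InClosedNbhd (Functigraph (Cycle 4) f) y v) →
  CommutesWithOpp f
dominating-pair⇒CommutesWithOpp f bij (inj₁ a) (inj₁ c) cover =
  ⊥-elim (two-points-cannot-cover (f a) (f c) (λ v → ⊎-map in-G₂ in-G₂ (cover (inj₂ v))))
  where
  in-G₂ : ∀ {u v} → InClosedNbhd (Functigraph (Cycle 4) f) (inj₁ u) (inj₂ v) → v ≡ f u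
  in-G₂ = [ (λ ()) , id ]
dominating-pair⇒CommutesWithOpp f bij (inj₂ b) (inj₂ d) cover =
  ⊥-elim (two-points-cannot-cover b d (λ v → ⊎-map (in-G₁ v) (in-G₁ v) (cover (inj₁ (from v)))))
  where
  open Inverse (⤖⇒↔ (mk⤖ bij)) using (from; inverseˡ)
  in-G₁ : ∀ {w} v → InClosedNbhd (Functigraph (Cycle 4) f) (inj₂ w) (inj₁ (from v)) → v ≡ w
  in-G₁ v = [ (λ ()) , (λ w≡f-from-v → sym (trans w≡f-from-v (inverseˡ refl))) ]
dominating-pair⇒CommutesWithOpp f bij (inj₂ b) (inj₁ a) cover =
  dominating-pair⇒CommutesWithOpp f bij (inj₁ a) (inj₂ b) (swap ∘ cover)
dominating-pair⇒CommutesWithOpp f bij (inj₁ a) (inj₂ b) cover =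
  commutes-with-opp-at⇒CommutesWithOpp f (proj₁ bij)
    (trans f-opp-a≡b (trans (sym (opp-involutive b)) (cong opp (sym f-a≡opp-b))))
  where
  f-opp-a≡b : f (opp a) ≡ b
  f-opp-a≡b with cover (inj₁ (opp a))
  ... | inj₁ closed     = ⊥-elim (opp-∉-closedNbhd a (map₁ inj₁-injective closed))
  ... | inj₂ (inj₁ ())
  ... | inj₂ (inj₂ b≡f) = sym b≡f
  f-a≡opp-b : f a ≡ opp b
  f-a≡opp-b with cover (inj₂ (opp b))
  ... | inj₁ (inj₁ ())
  ... | inj₁ (inj₂ opp-b≡f) = sym opp-b≡f
  ... | inj₂ closed         = ⊥-elim (opp-∉-closedNbhd b (map₁ inj₂-injective closed))

dominating-pair⇒≅ : (f : Fin 4 → Fin 4) → Bijective _≡_ _≡_ f → (D : List (Fin 4 ⊎ Fin 4)) →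
                    length D ≡ 2 → Dominating (Functigraph (Cycle 4) f) D →
                    Functigraph (Cycle 4) f ≅ Functigraph (Cycle 4) id
dominating-pair⇒≅ f bij (x ∷ y ∷ []) _ dom =
  automorphism⇒Functigraph-≅-id (Cycle 4) f bij
    (CommutesWithOpp⇒automorphism f (proj₁ bij)
      (dominating-pair⇒CommutesWithOpp f bij x y (dominating-pair (Functigraph (Cycle 4) f) dom)))
dominating-pair⇒≅ f bij [] ()
dominating-pair⇒≅ f bij (_ ∷ []) ()
dominating-pair⇒≅ f bij (_ ∷ _ ∷ _ ∷ _) ()

antipodal-pair : List (Fin 4 ⊎ Fin 4)
antipodal-pair = inj₁ 0F ∷ inj₂ 2F ∷ []

antipodal-pair-unique : Unique antipodal-pair
antipodal-pair-unique = ((λ ()) ∷ []) ∷ [] ∷ []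

antipodal-pair-dominating : Dominating (Functigraph (Cycle 4) id) antipodal-pair
antipodal-pair-dominating (inj₁ 0F) = inj₁ (here refl)
antipodal-pair-dominating (inj₁ 1F) = inj₂ (inj₁ 0F , here refl , inj₁ refl)
antipodal-pair-dominating (inj₁ 2F) = inj₂ (inj₂ 2F , there (here refl) , refl)
antipodal-pair-dominating (inj₁ 3F) = inj₂ (inj₁ 0F , here refl , inj₂ refl)
antipodal-pair-dominating (inj₂ 0F) = inj₂ (inj₁ 0F , here refl , refl)
antipodal-pair-dominating (inj₂ 1F) = inj₂ (inj₂ 2F , there (here refl) , inj₂ refl)
antipodal-pair-dominating (inj₂ 2F) = inj₁ (there (here refl))
antipodal-pair-dominating (inj₂ 3F) = inj₂ (inj₂ 2F , there (here refl) , inj₁ refl)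

γ-Cycle-upper : ∀ {n k} .{{_ : NonZero n}} → IsDominationNumber (Cycle n) k → 3 * k ≤ n + 2
γ-Cycle-upper {n} (_ , minimal) with Cycle-dominating-set n
... | D , unique , dom , 3|D|≤n+2 = ≤-trans (*-monoʳ-≤ 3 (minimal D unique dom)) 3|D|≤n+2

γ-Functigraph-lower : ∀ {n k} .{{_ : NonZero n}} (f : Fin n → Fin n) → Bijective _≡_ _≡_ f →
                      IsDominationNumber (Functigraph (Cycle n) f) k → n + n ≤ 4 * k
γ-Functigraph-lower f bij ((D , _ , dom , |D|≡k) , _) =
  subst (λ l → _ ≤ 4 * l) |D|≡k (Functigraph-Dominating⇒≤ f bij D dom)

γ-Cycle₄ : IsDominationNumber (Cycle 4) 2
γ-Cycle₄ with Cycle-dominating-set 4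
... | D , unique , dom , 3|D|≤6 =
  isDominationNumber (Cycle 4) D unique dom (*-cancelˡ-≤ 3 3|D|≤6)
    (λ D′ _ dom′ → *-cancelˡ-< 3 1 (length D′) (Cycle-Dominating⇒≤ 4 D′ dom′))

γ-Functigraph₄ : (f : Fin 4 → Fin 4) → Bijective _≡_ _≡_ f →
                 Functigraph (Cycle 4) f ≅ Functigraph (Cycle 4) id →
                 IsDominationNumber (Functigraph (Cycle 4) f) 2
γ-Functigraph₄ f bij iso
  with ≅-Dominating iso antipodal-pair antipodal-pair-unique antipodal-pair-dominating
... | D , unique , dom , |D|≡2 =
  isDominationNumber (Functigraph (Cycle 4) f) D unique dom (≤-reflexive |D|≡2)
    (λ D′ _ dom′ → *-cancelˡ-≤ 4 (Functigraph-Dominating⇒≤ f bij D′ dom′))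

domination-bounds⇒n≡4 : ∀ {n k} → 3 ≤ n → n + n ≤ 4 * k → 3 * k ≤ n + 2 → n ≡ 4 × k ≡ 2
domination-bounds⇒n≡4 {n} {k} 3≤n 2n≤4k 3k≤n+2 = ≤-antisym n≤4 4≤n , ≤-antisym k≤2 2≤k
  where
  open ≤-Reasoning
  2[3k]≡4k+2k : ∀ x → 2 * (3 * x) ≡ 4 * x + 2 * x
  2[3k]≡4k+2k = solve-∀
  2[n+2]≡n+n+4 : ∀ x → 2 * (x + 2) ≡ (x + x) + 4
  2[n+2]≡n+n+4 = solve-∀
  2≤k : 2 ≤ k
  2≤k = *-cancelˡ-< 4 1 k (≤-trans (n≤1+n 5) (≤-trans (+-mono-≤ 3≤n 3≤n) 2n≤4k))
  k≤2 : k ≤ 2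
  k≤2 = *-cancelˡ-≤ 2 (+-cancelˡ-≤ (4 * k) _ _ (begin
    4 * k + 2 * k  ≡⟨ 2[3k]≡4k+2k k ⟨
    2 * (3 * k)    ≤⟨ *-monoʳ-≤ 2 3k≤n+2 ⟩
    2 * (n + 2)    ≡⟨ 2[n+2]≡n+n+4 n ⟩
    (n + n) + 4    ≤⟨ +-monoˡ-≤ 4 2n≤4k ⟩
    4 * k + 4      ∎))
  n≤4 : n ≤ 4
  n≤4 = *-cancelˡ-≤ 2 (begin
    2 * n    ≡⟨ cong (n +_) (+-identityʳ n) ⟩
    n + n    ≤⟨ 2n≤4k ⟩
    4 * k    ≤⟨ *-monoʳ-≤ 4 k≤2 ⟩
    2 * 4    ∎)
  4≤n : 4 ≤ n
  4≤n = +-cancelʳ-≤ 2 4 n (≤-trans (*-monoʳ-≤ 3 2≤k) 3k≤n+2)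

same-γ⇒≅ : ∀ n .{{_ : NonZero n}} → 3 ≤ n → (f : Fin n → Fin n) → Bijective _≡_ _≡_ f →
           SameDominationNumber (Functigraph (Cycle n) f) (Cycle n) →
           Functigraph (Cycle n) f ≅ Functigraph (Cycle 4) id
same-γ⇒≅ n 3≤n f bij (k , γ-F , γ-C)
  with domination-bounds⇒n≡4 {n} {k} 3≤n (γ-Functigraph-lower f bij γ-F) (γ-Cycle-upper γ-C)
... | refl , refl = let ((D , _ , dom , |D|≡2) , _) = γ-F in dominating-pair⇒≅ f bij D |D|≡2 dom

≅⇒same-γ : ∀ n .{{_ : NonZero n}} (f : Fin n → Fin n) → Bijective _≡_ _≡_ f →
           Functigraph (Cycle n) f ≅ Functigraph (Cycle 4) id →
           SameDominationNumber (Functigraph (Cycle n) f) (Cycle n)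
≅⇒same-γ n f bij iso with ≅-Functigraph-Cycle⇒≡ iso
... | refl = 2 , γ-Functigraph₄ f bij iso , γ-Cycle₄

proposition3p7 : (n : ℕ) .{{_ : NonZero n}} → 3 ≤ n →
    (f : Fin n → Fin n) → Bijective _≡_ _≡_ f →
    (SameDominationNumber (Functigraph (Cycle n) f) (Cycle n)
      ⇔ (Functigraph (Cycle n) f ≅ Functigraph (Cycle 4) id))
proposition3p7 n 3≤n f bij = mk⇔ (same-γ⇒≅ n 3≤n f bij) (≅⇒same-γ n f bij)
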